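{- For any signed linear genome $G$ on $\{0,1,\ldots,2n+1\}$, $$psdcj(G)\ \ge\ n+1+c(BG(G))-2c_1(BG(G))-\begin{cases}0 & \text{if } \{0,1\}\in G,\\ 2 & \text{otherwise.}\end{cases}$$
   Context: A signed permutation $\pi$ of $\{\pm1,\ldots,\pm n\}$ is a bijection of that set onto itself with $\pi_{ -i}=-\pi_i$; we write it as the sequence $\pi_1\,\pi_2\cdots\pi_n$. Its unsigned translation $\pi'$ is the sequence of length $2n+2$ obtained by replacing each $\pi_i$ by $(2\pi_i-1,2\pi_i)$ if $\pi_i>0$ and by $(2|\pi_i|,2|\pi_i|-1)$ if $\pi_i<0$, and adding $\pi'_0=0$ and $\pi'_{2n+1}=2n+1$. A signed genome is a perfect matching on $\{0,1,\ldots,2n+1\}$; it is linear if there is a signed permutation $\pi$ with edge set $\{\{\pi'_{2i},\pi'_{2i+1}\}: 0\le i\le n\}$. The signed identity genome is the matching $\{\{2i,2i+1\}:0\le i\le n\}$. A DCJ on a signed genome removes two distinct edges $\{u,v\},\{w,x\}$ and adds either $\{u,w\},\{v,x\}$ or $\{u,x\},\{v,w\}$; it is a prefix DCJ if one of the removed edges contains $0$. $psdcj(G)$ is the minimum number of prefix DCJs transforming $G$ into the signed identity genome. The breakpoint graph $BG(G)$ is the edge-bicoloured multigraph on $\{0,\ldots,2n+1\}$ whose black edges are the edges of $G$ and whose grey edges are those of the signed identity genome; it is a disjoint union of cycles alternating between black and grey edges. The length of such a cycle is its number of black edges; $c(BG(G))$ is the number of cycles and $c_1(BG(G))$ the number of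 cycles of length $1$. -}

module Defs where

open import Data.Nat using (ℕ; zero; suc; _+_; _*_; _∸_; _<ᵇ_; _≡ᵇ_; _≤ᵇ_)
open import Data.Nat.DivMod using (_%_)
open import Data.Integer as ℤ using (ℤ; +_; -[1+_]; ∣_∣)
open import Data.Fin using (Fin; toℕ; zero; suc) renaming (_≟_ to _≟F_)
open import Data.Bool using (Bool; true; false; _∧_; _∨_; not; if_then_else_)
open import Data.List using (List; []; _∷_; _++_; map; concatMap; filter; length; upTo; allFin)
open import Data.Bool.ListAction using (any; all)
open import Data.List.Membership.Propositional using (_∈_)
open import Data.List.Relation.Binary.Permutation.Propositional using (_↭_)
open import Data.Product using (Σ; ∃; _×_; _,_)
open import Data.Sum using (_⊎_)
open import Relation.Nullary using (¬_; Dec; yes; no)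
open import Relation.Nullary.Decidable using (⌊_⌋)
open import Relation.Binary.PropositionalEquality using (_≡_)
open import Function.Bundles using (_⇔_)

V : ℕ → Set
V n = Fin (2 + 2 * n)

-- grey partner in the signed identity genome {{2i,2i+1}}
greyℕ : ℕ → ℕ
greyℕ x = if x % 2 ≡ᵇ 0 then suc x else x ∸ 1

-- Signed genome = perfect matching on {0,...,2n+1},
-- represented by the (fixed-point-free, involutive) partner map:
-- {a,b} is an edge iff  m a ≡ b.

record Genome (n : ℕ) : Set where
  field
    m     : V n → V n
    invol : ∀ x → m (m x) ≡ x
    nofix : ∀ x → ¬ (m x ≡ x)
open Genome public

Edge : ∀ {n} → Genome n → V n → V n → Set
Edge G a b = m G a ≡ b

IsIdentity : ∀ {n} → Genome n → Set
IsIdentity G = ∀ x → toℕ (m G x) ≡ greyℕ (toℕ x)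

-- Signed permutations, written as the sequence π₁ … πₙ
-- (π₋ᵢ = -πᵢ determines the rest).

record SignedPerm (n : ℕ) : Set where
  field
    seq  : List ℤ
    len  : length seq ≡ n
    perm : map ∣_∣ seq ↭ map suc (upTo n)
open SignedPerm public

translate : ℤ → List ℕ
translate (+ zero)  = []          -- never occurs for a signed permutation
translate (+ suc a) = (2 * suc a ∸ 1) ∷ 2 * suc a ∷ []
translate -[1+ a ]  = 2 * suc a ∷ (2 * suc a ∸ 1) ∷ []

unsignedTranslation : ∀ {n} → SignedPerm n → List ℕ
unsignedTranslation {n} π = 0 ∷ concatMap translate (seq π) ++ (suc (2 * n) ∷ [])

pairs : List ℕ → List (ℕ × ℕ)
pairs (a ∷ b ∷ r) = (a , b) ∷ pairs r
pairs _ = []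

Linear : ∀ {n} → Genome n → Set
Linear {n} G = Σ (SignedPerm n) λ π → ∀ (a b : V n) →
  Edge G a b ⇔ ( ((toℕ a , toℕ b) ∈ pairs (unsignedTranslation π))
               ⊎ ((toℕ b , toℕ a) ∈ pairs (unsignedTranslation π)) )

-- Prefix DCJ: remove distinct edges {u,v},{w,x} (one containing 0) and
-- add {u,w},{v,x}.  (The other option {u,x},{v,w} is the same
-- operation with w and x exchanged, so it is covered by the
-- quantification over u v w x.)

PrefixDCJ : ∀ {n} → Genome n → Genome n → Set
PrefixDCJ {n} G H = Σ (V n) λ u → Σ (V n) λ v → Σ (V n) λ w → Σ (V n) λ x →
    Edge G u v × Edge G w x
  × ¬ (u ≡ w) × ¬ (u ≡ x)
  × (toℕ u ≡ 0 ⊎ toℕ v ≡ 0 ⊎ toℕ w ≡ 0 ⊎ toℕ x ≡ 0)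
  × Edge H u w × Edge H v x
  × (∀ y → ¬ (y ≡ u) → ¬ (y ≡ v) → ¬ (y ≡ w) → ¬ (y ≡ x) → m H y ≡ m G y)

data PSortable {n : ℕ} : Genome n → ℕ → Set where
  done : ∀ {G} → IsIdentity G → PSortable G 0
  step : ∀ {G H k} → PrefixDCJ G H → PSortable H k → PSortable G (suc k)

PsdcjIs : ∀ {n} → Genome n → ℕ → Set
PsdcjIs G d = PSortable G d × (∀ k → PSortable G k → d Data.Nat.≤ k)

-- Breakpoint graph: black edges = edges of G, grey edges = edges of
-- the signed identity genome.  Cycles = connected components.

adjBG : ∀ {n} → Genome n → V n → V n → Bool
adjBG G u w = ⌊ m G u ≟F w ⌋ ∨ (toℕ w ≡ᵇ greyℕ (toℕ u))

grow : ∀ {n} → Genome n → (V n → Bool) → (V n → Bool)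
grow {n} G S w = S w ∨ any (λ u → S u ∧ adjBG G u w) (allFin (2 + 2 * n))

iter : ∀ {A : Set} → ℕ → (A → A) → A → A
iter zero    f a = a
iter (suc k) f a = f (iter k f a)

component : ∀ {n} → Genome n → V n → V n → Bool
component {n} G v = iter (2 + 2 * n) (grow G) (λ w → ⌊ w ≟F v ⌋)

-- v is the least vertex of its cycle (one representative per cycle)
isRep : ∀ {n} → Genome n → V n → Bool
isRep {n} G v = all (λ w → not (component G v w) ∨ (toℕ v ≤ᵇ toℕ w)) (allFin (2 + 2 * n))

-- length of the cycle through v = number of black edges {u, m u} in it
cycleLength : ∀ {n} → Genome n → V n → ℕ
cycleLength {n} G v =
  length (filter (λ u → Data.Bool.T? (component G v u ∧ (toℕ u <ᵇ toℕ (m G u)))) (allFin (2 + 2 * n)))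

cBG : ∀ {n} → Genome n → ℕ
cBG {n} G = length (filter (λ v → Data.Bool.T? (isRep G v)) (allFin (2 + 2 * n)))

c1BG : ∀ {n} → Genome n → ℕ
c1BG {n} G = length (filter (λ v → Data.Bool.T? (isRep G v ∧ (cycleLength G v ≡ᵇ 1))) (allFin (2 + 2 * n)))

zeroOneEdge : ∀ {n} → Genome n → Bool
zeroOneEdge G = toℕ (m G zero) ≡ᵇ 1

lowerBound : ∀ {n} → Genome n → ℤ
lowerBound {n} G =
  ((+ (n + 1) ℤ.+ + cBG G) ℤ.- (+ 2) ℤ.* (+ c1BG G))
  ℤ.- (if zeroOneEdge G then + 0 else + 2)

-- Write Φ(K) = c(BG(K)) − 2 c₁(BG(K)) − (0 if {0,1} ∈ K, else 2). The identity genome has n + 1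
-- cycles, all of length 1, so Φ = −(n + 1) there, and the theorem follows once a prefix DCJ is shown
-- to lower Φ by at most one.
--
-- A DCJ replacing the black edges {u,v}, {w,x} of G by {u,w}, {v,x} in H changes c by at most one:
-- both breakpoint graphs arise from their common edges S by adding two edges, and {u,w} closes a
-- cycle of BG(H) through {v,x}, so c(BG(H)) = c(S + {v,x}) ≥ c(S) − 1 ≥ c(BG(G)) − 1.
-- The 1-cycles change only at u, v, w, x. The DCJ is symmetric under u ↔ v, w ↔ x and under
-- u ↔ w, v ↔ x, so we may assume u = 0; then the correction term for {0,1} exactly cancels the
-- possible 1-cycle {u,v}, and c₁ can only gain the 1-cycle {v,x}. In that case {v,x} is a whole
-- component of S, so u and v are disconnected in S and c(BG(H)) ≥ c(BG(G)) + 1.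

module Submission where

open import Defs hiding (grow; component; isRep)
open import Data.Nat using (ℕ; zero; suc; _+_; _*_; _∸_; _≤_; _<_; _≤ᵇ_; _<ᵇ_; _≡ᵇ_; z≤n; s≤s)
open import Data.Nat.Properties hiding (_≟_; suc-injective)
open import Data.Nat.DivMod using (_%_)
open import Data.Nat.Tactic.RingSolver using (solve-∀)
open import Data.Integer as ℤ using (ℤ; _⊖_)
import Data.Integer.Properties as ℤ
open import Data.Integer.Tactic.RingSolver using () renaming (solve-∀ to ℤ-solve-∀)
open import Data.Fin using (Fin; zero; suc; toℕ; _≟_)
open import Data.Fin.Properties using (toℕ-injective; suc-injective; all?; ¬∀⟶∃¬; pigeonhole)
open import Data.Bool using (Bool; true; false; _∧_; _∨_; not; T; if_then_else_)
open import Data.Bool.Properties using (∨-comm; if-float) renaming (_≟_ to _≟ᵇ_)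
open import Data.Bool.ListAction using (any; all)
open import Data.List using (List; []; _∷_; filter; length; allFin; tabulate)
open import Data.List.Properties using (length-tabulate)
open import Data.List.Membership.Propositional using (_∈_)
open import Data.List.Membership.Propositional.Properties using (∈-allFin)
open import Data.List.Relation.Unary.Any using (here; there)
open import Data.Product using (Σ; ∃; _×_; _,_; proj₁; proj₂)
open import Data.Sum using (_⊎_; inj₁; inj₂)
open import Data.Empty using (⊥-elim)
open import Function using (_∘_)
open import Function.Definitions using (Injective)
open import Relation.Nullary using (¬_; Dec; yes; no)
open import Relation.Nullary.Decidable using (⌊_⌋; T?; decidable-stable)
open import Relation.Binary.Definitions using (tri<; tri≈; tri>)
open import Relation.Binary.Construct.Closure.ReflexiveTransitive
  using (Star; ε; _◅_; _◅◅_; return; reverse) renaming (map to Star-map)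
open import Relation.Binary.PropositionalEquality

∨-true : ∀ {a b} → a ∨ b ≡ true → a ≡ true ⊎ b ≡ true
∨-true {true}  _ = inj₁ refl
∨-true {false} e = inj₂ e

∨-trueˡ : ∀ {a} b → a ≡ true → a ∨ b ≡ true
∨-trueˡ b refl = refl

∨-trueʳ : ∀ a {b} → b ≡ true → a ∨ b ≡ true
∨-trueʳ true  _ = refl
∨-trueʳ false e = e

∧-true : ∀ {a b} → a ∧ b ≡ true → a ≡ true × b ≡ true
∧-true {true} {true} _ = refl , refl

∧-true⁺ : ∀ {a b} → a ≡ true → b ≡ true → a ∧ b ≡ true
∧-true⁺ refl refl = refl

≡true-ext : ∀ {a b} → (a ≡ true → b ≡ true) → (b ≡ true → a ≡ true) → a ≡ b
≡true-ext {false} {false} _ _ = refl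
≡true-ext {false} {true}  _ g = g refl
≡true-ext {true}  {false} f _ = sym (f refl)
≡true-ext {true}  {true}  _ _ = refl

false≢true : false ≢ true
false≢true ()

T⇒≡true : ∀ {a} → T a → a ≡ true
T⇒≡true {true} _ = refl

strictly-⊇ : ∀ {a b} → (a ≡ true → b ≡ true) → a ≢ b → a ≡ false × b ≡ true
strictly-⊇ {false} {false} _   a≢b = ⊥-elim (a≢b refl)
strictly-⊇ {false} {true}  _   _   = refl , refl
strictly-⊇ {true}  {false} a⇒b _   = ⊥-elim (false≢true (a⇒b refl))
strictly-⊇ {true}  {true}  _   a≢b = ⊥-elim (a≢b refl)

any-true : ∀ {A : Set} (p : A → Bool) xs → any p xs ≡ true → ∃ λ x → p x ≡ true
any-true p (x ∷ xs) e with p x in px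
... | true  = x , px
... | false = any-true p xs e

any-true⁺ : ∀ {A : Set} (p : A → Bool) {x} xs → x ∈ xs → p x ≡ true → any p xs ≡ true
any-true⁺ p (y ∷ xs) (here refl) py rewrite py = refl
any-true⁺ p (y ∷ xs) (there x∈xs) px = ∨-trueʳ (p y) (any-true⁺ p xs x∈xs px)

all-true : ∀ {A : Set} (p : A → Bool) {x} xs → all p xs ≡ true → x ∈ xs → p x ≡ true
all-true p (y ∷ xs) e (here refl)  = proj₁ (∧-true e)
all-true p (y ∷ xs) e (there x∈xs) = all-true p xs (proj₂ (∧-true {p y} e)) x∈xs

all-true⁺ : ∀ {A : Set} (p : A → Bool) xs → (∀ x → p x ≡ true) → all p xs ≡ true
all-true⁺ p []       _   = refl
all-true⁺ p (x ∷ xs) all rewrite all x = all-true⁺ p xs all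


_==_ : ∀ {N} → Fin N → Fin N → Bool
a == b = ⌊ a ≟ b ⌋

==⇒≡ : ∀ {N} {a b : Fin N} → a == b ≡ true → a ≡ b
==⇒≡ {a = a} {b} e with a ≟ b
... | yes a≡b = a≡b

≡⇒== : ∀ {N} {a b : Fin N} → a ≡ b → a == b ≡ true
≡⇒== {a = a} refl with a ≟ a
... | yes _ = refl
... | no a≢a = ⊥-elim (a≢a refl)

≢⇒==false : ∀ {N} {a b : Fin N} → a ≢ b → a == b ≡ false
≢⇒==false {a = a} {b} a≢b with a ≟ b
... | yes a≡b = ⊥-elim (a≢b a≡b)
... | no _    = refl

==-refl : ∀ {N} (a : Fin N) → a == a ≡ true
==-refl a = ≡⇒== refl

suc==suc : ∀ {N} (a b : Fin N) → suc a == suc b ≡ a == b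
suc==suc a b = ≡true-ext (≡⇒== ∘ suc-injective ∘ ==⇒≡) (≡⇒== ∘ cong suc ∘ ==⇒≡)

ind : Bool → ℕ
ind true  = 1
ind false = 0

-- The form in which Defs counts cycles, so that cBG and c1BG are instances of card.
count : ∀ {A : Set} → (A → Bool) → List A → ℕ
count p xs = length (filter (T? ∘ p) xs)

module _ {A : Set} where

  count-∷ : ∀ (p : A → Bool) x xs → count p (x ∷ xs) ≡ ind (p x) + count p xs
  count-∷ p x xs with p x
  ... | true  = refl
  ... | false = refl

  count-cong : ∀ {p q : A → Bool} → (∀ x → p x ≡ q x) → ∀ xs → count p xs ≡ count q xs
  count-cong e [] = refl
  count-cong {p} {q} e (x ∷ xs) = begin
    count p (x ∷ xs)         ≡⟨ count-∷ p x xs ⟩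
    ind (p x) + count p xs   ≡⟨ cong₂ _+_ (cong ind (e x)) (count-cong e xs) ⟩
    ind (q x) + count q xs   ≡⟨ count-∷ q x xs ⟨
    count q (x ∷ xs)         ∎
    where open ≡-Reasoning

  count-split : ∀ (p q : A → Bool) xs →
    count p xs ≡ count (λ x → q x ∧ p x) xs + count (λ x → not (q x) ∧ p x) xs
  count-split p q [] = refl
  count-split p q (x ∷ xs)
    rewrite count-∷ p x xs | count-∷ (λ x → q x ∧ p x) x xs
          | count-∷ (λ x → not (q x) ∧ p x) x xs | count-split p q xs
    with q x | p x
  ... | true  | false = refl
  ... | false | false = refl
  ... | true  | true  = refl
  ... | false | true  = sym (+-suc _ _)

  count-mono : ∀ {p q : A → Bool} → (∀ x → p x ≡ true → q x ≡ true) →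
               ∀ xs → count p xs ≤ count q xs
  count-mono p⇒q [] = z≤n
  count-mono {p} {q} p⇒q (x ∷ xs)
    rewrite count-∷ p x xs | count-∷ q x xs
    = +-mono-≤ (ind-mono (p⇒q x)) (count-mono p⇒q xs)
    where
    ind-mono : ∀ {a b} → (a ≡ true → b ≡ true) → ind a ≤ ind b
    ind-mono {false} _ = z≤n
    ind-mono {true}  f rewrite f refl = ≤-refl

  count-none : ∀ {p : A → Bool} → (∀ x → p x ≡ false) → ∀ xs → count p xs ≡ 0
  count-none none [] = refl
  count-none {p} none (x ∷ xs) rewrite count-∷ p x xs | none x = count-none none xs

  count-pos : ∀ {p : A → Bool} {x} xs → x ∈ xs → p x ≡ true → 1 ≤ count p xs
  count-pos {p} (y ∷ xs) (here refl) py rewrite count-∷ p y xs | py = s≤s z≤n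
  count-pos {p} (y ∷ xs) (there x∈xs) px rewrite count-∷ p y xs =
    ≤-trans (count-pos xs x∈xs px) (m≤n+m _ (ind (p y)))

  count≤length : ∀ (p : A → Bool) xs → count p xs ≤ length xs
  count≤length p [] = z≤n
  count≤length p (x ∷ xs) rewrite count-∷ p x xs with p x
  ... | true  = s≤s (count≤length p xs)
  ... | false = m≤n⇒m≤1+n (count≤length p xs)

count-tabulate : ∀ {N} {A : Set} (f : Fin N → A) (p : A → Bool) →
                 count p (tabulate f) ≡ count (p ∘ f) (allFin N)
count-tabulate {zero}  f p = refl
count-tabulate {suc N} f p
  rewrite count-∷ p (f zero) (tabulate (f ∘ suc)) | count-∷ (p ∘ f) zero (tabulate suc)
        | count-tabulate (f ∘ suc) p | count-tabulate {N} suc (p ∘ f) = refl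

card : ∀ {N} → (Fin N → Bool) → ℕ
card {N} p = count p (allFin N)

card≤N : ∀ {N} (p : Fin N → Bool) → card p ≤ N
card≤N {N} p = subst (card p ≤_) (length-tabulate {n = N} (λ i → i)) (count≤length p (allFin N))

card-singleton : ∀ {N} (a : Fin N) → card (_== a) ≡ 1
card-singleton {suc N} zero
  rewrite count-∷ (λ y → _==_ {suc N} y zero) zero (tabulate suc) | count-tabulate suc (λ y → _==_ {suc N} y zero) =
  cong suc (count-none (λ _ → refl) (allFin N))
card-singleton {suc N} (suc a)
  rewrite count-∷ (_== suc a) zero (tabulate suc) | count-tabulate suc (_== suc a) =
  trans (count-cong (λ y → suc==suc y a) (allFin N)) (card-singleton a)

_∖_ : ∀ {N} → (Fin N → Bool) → Fin N → Fin N → Bool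
(p ∖ a) y = not (y == a) ∧ p y

∖-≢ : ∀ {N} (p : Fin N → Bool) {a b} → b ≢ a → (p ∖ a) b ≡ p b
∖-≢ p b≢a rewrite ≢⇒==false b≢a = refl

∖-cong : ∀ {N} {p q : Fin N → Bool} a y → (y ≢ a → p y ≡ q y) → (p ∖ a) y ≡ (q ∖ a) y
∖-cong a y agree with y ≟ a
... | yes _   = refl
... | no y≢a = agree y≢a

card-∖ : ∀ {N} (p : Fin N → Bool) a → card p ≡ card (p ∖ a) + ind (p a)
card-∖ {N} p a = begin
  card p                                    ≡⟨ count-split p (_== a) (allFin N) ⟩
  card (λ y → y == a ∧ p y) + card (p ∖ a)  ≡⟨ +-comm _ (card (p ∖ a)) ⟩
  card (p ∖ a) + card (λ y → y == a ∧ p y)  ≡⟨ cong (card (p ∖ a) +_) at-a ⟩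
  card (p ∖ a) + ind (p a)                  ∎
  where
  open ≡-Reasoning
  at-a : card (λ y → y == a ∧ p y) ≡ ind (p a)
  at-a with p a in pa
  ... | true  = trans (count-cong only-a (allFin N)) (card-singleton a)
    where
    only-a : ∀ y → y == a ∧ p y ≡ y == a
    only-a y with y ≟ a
    ... | yes refl = pa
    ... | no _     = refl
  ... | false = count-none none (allFin N)
    where
    none : ∀ y → y == a ∧ p y ≡ false
    none y with y ≟ a
    ... | yes refl = pa
    ... | no _     = refl

card≡1 : ∀ {N} (p : Fin N → Bool) a → p a ≡ true → (∀ y → p y ≡ true → y ≡ a) → card p ≡ 1
card≡1 {N} p a pa unique = trans (count-cong p≡[a] (allFin N)) (card-singleton a)
  where
  p≡[a] : ∀ y → p y ≡ y == a
  p≡[a] y = ≡true-ext (λ py → ≡⇒== (unique y py)) (λ y≡a → subst (λ z → p z ≡ true) (sym (==⇒≡ y≡a)) pa)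

2≤card : ∀ {N} (p : Fin N → Bool) a b → p a ≡ true → p b ≡ true → b ≢ a → 2 ≤ card p
2≤card {N} p a b pa pb b≢a rewrite card-∖ p a | pa =
  subst (2 ≤_) (+-comm 1 _) (s≤s (count-pos (allFin N) (∈-allFin b) (trans (∖-≢ p b≢a) pb)))

card-<  : ∀ {N} (p q : Fin N → Bool) → (∀ x → p x ≡ true → q x ≡ true) →
          ∀ a → q a ≡ true → p a ≡ false → card p < card q
card-< {N} p q p⇒q a qa pa rewrite card-∖ p a | card-∖ q a | pa | qa =
  subst₂ _≤_ (cong suc (sym (+-identityʳ _))) (+-comm 1 _) (s≤s (count-mono ∖-mono (allFin N)))
  where
  ∖-mono : ∀ x → (p ∖ a) x ≡ true → (q ∖ a) x ≡ true
  ∖-mono x e with ∧-true {not (x == a)} e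
  ... | x≢a , px = ∧-true⁺ x≢a (p⇒q x px)

card-∖₄ : ∀ {N} (p : Fin N → Bool) {a b c d} → b ≢ a → c ≢ a → c ≢ b → d ≢ a → d ≢ b → d ≢ c →
  card p ≡ card ((((p ∖ a) ∖ b) ∖ c) ∖ d) + (ind (p a) + ind (p b) + ind (p c) + ind (p d))
card-∖₄ p {a} {b} {c} {d} b≢a c≢a c≢b d≢a d≢b d≢c
  rewrite card-∖ p a | card-∖ (p ∖ a) b | card-∖ ((p ∖ a) ∖ b) c | card-∖ (((p ∖ a) ∖ b) ∖ c) d
        | ∖-≢ p b≢a | ∖-≢ (p ∖ a) c≢b | ∖-≢ p c≢a | ∖-≢ ((p ∖ a) ∖ b) d≢c | ∖-≢ (p ∖ a) d≢b | ∖-≢ p d≢a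
  = reorder (card ((((p ∖ a) ∖ b) ∖ c) ∖ d)) (ind (p a)) (ind (p b)) (ind (p c)) (ind (p d))
  where
  reorder : ∀ r i j k l → r + l + k + j + i ≡ r + (i + j + k + l)
  reorder = solve-∀

∖₄-cong : ∀ {N} {p q : Fin N → Bool} a b c d →
  (∀ y → y ≢ a → y ≢ b → y ≢ c → y ≢ d → p y ≡ q y) →
  ∀ y → ((((p ∖ a) ∖ b) ∖ c) ∖ d) y ≡ ((((q ∖ a) ∖ b) ∖ c) ∖ d) y
∖₄-cong {p = p} {q} a b c d agree y =
  ∖-cong {p = ((p ∖ a) ∖ b) ∖ c} {((q ∖ a) ∖ b) ∖ c} d y λ y≢d →
  ∖-cong {p = (p ∖ a) ∖ b} {(q ∖ a) ∖ b} c y λ y≢c →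
  ∖-cong {p = p ∖ a} {q ∖ a} b y λ y≢b →
  ∖-cong {p = p} {q} a y λ y≢a → agree y y≢a y≢b y≢c y≢d

least : ∀ {N} (P : Fin N → Bool) a → P a ≡ true →
        Σ (Fin N) λ m → P m ≡ true × (∀ y → P y ≡ true → toℕ m ≤ toℕ y)
least {suc N} P a Pa with P zero in P0
... | true = zero , P0 , λ _ _ → z≤n
least {suc N} P zero    Pa | false = ⊥-elim (false≢true (trans (sym P0) Pa))
least {suc N} P (suc a) Pa | false with least (P ∘ suc) a Pa
... | m , Pm , minimal = suc m , Pm , minimal′
  where
  minimal′ : ∀ y → P y ≡ true → toℕ (suc m) ≤ toℕ y
  minimal′ zero    Py = ⊥-elim (false≢true (trans (sym P0) Py))
  minimal′ (suc y) Py = s≤s (minimal y Py)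

-- Finite graphs and their components

Graph : ℕ → Set
Graph N = Fin N → Fin N → Bool

module _ {N : ℕ} where

  Arc : Graph N → Fin N → Fin N → Set
  Arc E x y = E x y ≡ true

  Reach : Graph N → Fin N → Fin N → Set
  Reach E = Star (Arc E)

  Symmetric : Graph N → Set
  Symmetric E = ∀ {x y} → Arc E x y → Arc E y x

  _⊆_ : Graph N → Graph N → Set
  E ⊆ F = ∀ {x y} → Arc E x y → Arc F x y

  Closed : Graph N → (Fin N → Bool) → Set
  Closed E S = ∀ {u w} → S u ≡ true → Arc E u w → S w ≡ true

  closed-reach : ∀ {E S} → Closed E S → ∀ {x y} → Reach E x y → S x ≡ true → S y ≡ true
  closed-reach closed ε        Sx = Sx
  closed-reach closed (e ◅ xs) Sx = closed-reach closed xs (closed Sx e)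

  reach-snoc : ∀ {E x y z} → Reach E x y → Arc E y z → Reach E x z
  reach-snoc xs e = xs ◅◅ return e

  grow : Graph N → (Fin N → Bool) → Fin N → Bool
  grow E S w = S w ∨ any (λ u → S u ∧ E u w) (allFin N)

  component : Graph N → Fin N → Fin N → Bool
  component E v = iter N (grow E) (_== v)

  grow-⊇ : ∀ E S w → S w ≡ true → grow E S w ≡ true
  grow-⊇ E S w = ∨-trueˡ _

  iter-grow-⊇ : ∀ E k S w → S w ≡ true → iter k (grow E) S w ≡ true
  iter-grow-⊇ E zero    S w Sw = Sw
  iter-grow-⊇ E (suc k) S w Sw = grow-⊇ E _ w (iter-grow-⊇ E k S w Sw)

  iter-grow-reach : ∀ E v k S → (∀ w → S w ≡ true → Reach E v w) →
                    ∀ w → iter k (grow E) S w ≡ true → Reach E v w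
  iter-grow-reach E v zero    S S⊆ w Sw = S⊆ w Sw
  iter-grow-reach E v (suc k) S S⊆ w e with ∨-true e
  ... | inj₁ old = iter-grow-reach E v k S S⊆ w old
  ... | inj₂ new with any-true _ (allFin N) new
  ... | u , e′ = reach-snoc (iter-grow-reach E v k S S⊆ u (proj₁ (∧-true e′))) (proj₂ (∧-true e′))

  component⇒reach : ∀ E v w → component E v w ≡ true → Reach E v w
  component⇒reach E v = iter-grow-reach E v N (_== v) (λ w w≡v → subst (Reach E v) (sym (==⇒≡ w≡v)) ε)

  closed-grow : ∀ E S → Closed E S → Closed E (grow E S)
  closed-grow E S closed {u} Su e with ∨-true Su
  ... | inj₁ Su′ = ∨-trueˡ _ (closed Su′ e)
  ... | inj₂ new with any-true _ (allFin N) new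
  ... | y , e′ = ∨-trueˡ _ (closed (closed (proj₁ (∧-true e′)) (proj₂ (∧-true e′))) e)

  grow-closed-or-< : ∀ E S → Closed E S ⊎ card S < card (grow E S)
  grow-closed-or-< E S with all? (λ w → S w ≟ᵇ grow E S w)
  ... | yes fixed = inj₁ λ {u} {w} Su e → trans (fixed w)
        (∨-trueʳ (S w) (any-true⁺ (λ u → S u ∧ E u w) (allFin N) (∈-allFin u) (∧-true⁺ Su e)))
  ... | no ¬fixed with ¬∀⟶∃¬ N _ (λ w → S w ≟ᵇ grow E S w) ¬fixed
  ... | w , Sw≢ with strictly-⊇ (grow-⊇ E S w) Sw≢
  ... | ¬Sw , Gw = inj₂ (card-< S (grow E S) (grow-⊇ E S) w Gw ¬Sw)

  -- Until it is closed, the k-th search round has at least k + 1 vertices, so N rounds suffice.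
  iter-grow-closed-or-large : ∀ E v k →
    Closed E (iter k (grow E) (_== v)) ⊎ suc k ≤ card (iter k (grow E) (_== v))
  iter-grow-closed-or-large E v zero = inj₂ (≤-reflexive (sym (card-singleton v)))
  iter-grow-closed-or-large E v (suc k) with iter-grow-closed-or-large E v k
  ... | inj₁ closed = inj₁ (closed-grow E _ closed)
  ... | inj₂ large with grow-closed-or-< E (iter k (grow E) (_== v))
  ... | inj₁ closed = inj₁ (closed-grow E _ closed)
  ... | inj₂ bigger = inj₂ (≤-trans (s≤s large) bigger)

  component-closed : ∀ E v → Closed E (component E v)
  component-closed E v with iter-grow-closed-or-large E v N
  ... | inj₁ closed = closed
  ... | inj₂ large  = ⊥-elim (<-irrefl refl (≤-trans large (card≤N (component E v))))

  reach⇒component : ∀ E v w → Reach E v w → component E v w ≡ true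
  reach⇒component E v w p = closed-reach (component-closed E v) p (iter-grow-⊇ E N (_== v) v (==-refl v))

  isRep : Graph N → Fin N → Bool
  isRep E v = all (λ w → not (component E v w) ∨ (toℕ v ≤ᵇ toℕ w)) (allFin N)

  IsLeast : Graph N → Fin N → Set
  IsLeast E v = ∀ w → Reach E v w → toℕ v ≤ toℕ w

  isRep-sound : ∀ E v → isRep E v ≡ true → IsLeast E v
  isRep-sound E v e w p with component E v w | reach⇒component E v w p
      | all-true (λ w → not (component E v w) ∨ (toℕ v ≤ᵇ toℕ w)) (allFin N) e (∈-allFin w)
  ... | true | _ | v≤w = ≤ᵇ⇒≤ (toℕ v) (toℕ w) (subst T (sym v≤w) _)

  isRep-complete : ∀ E v → IsLeast E v → isRep E v ≡ true
  isRep-complete E v v-least = all-true⁺ _ (allFin N) check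
    where
    check : ∀ w → not (component E v w) ∨ (toℕ v ≤ᵇ toℕ w) ≡ true
    check w with component E v w in vw
    ... | false = refl
    ... | true  = T⇒≡true (≤⇒≤ᵇ (v-least w (component⇒reach E v w vw)))

  -- As in Defs, components are found by N rounds of breadth-first search and counted by their
  -- least vertices: cBG K unfolds to #components (adjBG K).
  #components : Graph N → ℕ
  #components E = card (isRep E)

  #components-cong : ∀ E F → (∀ {x y} → Reach E x y → Reach F x y) → (∀ {x y} → Reach F x y → Reach E x y) →
                     #components E ≡ #components F
  #components-cong E F E⇒F F⇒E = count-cong same-reps (allFin N)
    where
    same-reps : ∀ v → isRep E v ≡ isRep F v
    same-reps v = ≡true-ext (λ e → isRep-complete F v (λ w → isRep-sound E v e w ∘ F⇒E))
                            (λ e → isRep-complete E v (λ w → isRep-sound F v e w ∘ E⇒F))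

  reach? : ∀ E x y → Dec (Reach E x y)
  reach? E x y with component E x y in xy
  ... | true  = yes (component⇒reach E x y xy)
  ... | false = no (λ p → false≢true (trans (sym xy) (reach⇒component E x y p)))

  addEdge : Fin N → Fin N → Graph N → Graph N
  addEdge a b E y z = E y z ∨ ((y == a ∧ z == b) ∨ (y == b ∧ z == a))

  module _ (a b : Fin N) (E : Graph N) where

    ⊆-addEdge : E ⊆ addEdge a b E
    ⊆-addEdge = ∨-trueˡ _

    addEdge-ab : Arc (addEdge a b E) a b
    addEdge-ab = ∨-trueʳ (E a b) (∨-trueˡ _ (∧-true⁺ (==-refl a) (==-refl b)))

    addEdge-ba : Arc (addEdge a b E) b a
    addEdge-ba = ∨-trueʳ (E b a) (∨-trueʳ (b == a ∧ a == b) (∧-true⁺ (==-refl b) (==-refl a)))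

    addEdge-arc : ∀ {y z} → Arc (addEdge a b E) y z → Arc E y z ⊎ (y ≡ a × z ≡ b) ⊎ (y ≡ b × z ≡ a)
    addEdge-arc {y} {z} e with ∨-true e
    ... | inj₁ old = inj₁ old
    ... | inj₂ new with ∨-true {y == a ∧ z == b} new
    ... | inj₁ ab = inj₂ (inj₁ (==⇒≡ (proj₁ (∧-true ab)) , ==⇒≡ (proj₂ (∧-true {y == a} ab))))
    ... | inj₂ ba = inj₂ (inj₂ (==⇒≡ (proj₁ (∧-true ba)) , ==⇒≡ (proj₂ (∧-true {y == b} ba))))

    addEdge-sym : Symmetric E → Symmetric (addEdge a b E)
    addEdge-sym E-sym e with addEdge-arc e
    ... | inj₁ old               = ⊆-addEdge (E-sym old)
    ... | inj₂ (inj₁ (refl , refl)) = addEdge-ba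
    ... | inj₂ (inj₂ (refl , refl)) = addEdge-ab

    -- A path in the enlarged graph uses the new edge at most once, up to shortcuts.
    ViaNewEdge : Fin N → Fin N → Set
    ViaNewEdge y z = Reach E y z ⊎ (Reach E y a × Reach E b z) ⊎ (Reach E y b × Reach E a z)

    reach-addEdge : ∀ {y z} → Reach (addEdge a b E) y z → ViaNewEdge y z
    reach-addEdge ε        = inj₁ ε
    reach-addEdge (e ◅ xs) = prepend (addEdge-arc e) (reach-addEdge xs)
      where
      prepend : ∀ {y y′ z} → Arc E y y′ ⊎ (y ≡ a × y′ ≡ b) ⊎ (y ≡ b × y′ ≡ a) →
                ViaNewEdge y′ z → ViaNewEdge y z
      prepend (inj₁ e) (inj₁ p)              = inj₁ (e ◅ p)
      prepend (inj₁ e) (inj₂ (inj₁ (p , q))) = inj₂ (inj₁ (e ◅ p , q))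
      prepend (inj₁ e) (inj₂ (inj₂ (p , q))) = inj₂ (inj₂ (e ◅ p , q))
      prepend (inj₂ (inj₁ (refl , refl))) (inj₁ p)              = inj₂ (inj₁ (ε , p))
      prepend (inj₂ (inj₁ (refl , refl))) (inj₂ (inj₁ (_ , q))) = inj₂ (inj₁ (ε , q))
      prepend (inj₂ (inj₁ (refl , refl))) (inj₂ (inj₂ (_ , q))) = inj₁ q
      prepend (inj₂ (inj₂ (refl , refl))) (inj₁ p)              = inj₂ (inj₂ (ε , p))
      prepend (inj₂ (inj₂ (refl , refl))) (inj₂ (inj₁ (_ , q))) = inj₁ q
      prepend (inj₂ (inj₂ (refl , refl))) (inj₂ (inj₂ (_ , q))) = inj₂ (inj₂ (ε , q))

  addEdge-comm : ∀ a b E y z → addEdge a b E y z ≡ addEdge b a E y z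
  addEdge-comm a b E y z = cong (E y z ∨_) (∨-comm (y == a ∧ z == b) (y == b ∧ z == a))

  #components-pointwise : ∀ E F → (∀ y z → E y z ≡ F y z) → #components E ≡ #components F
  #components-pointwise E F E≡F =
    #components-cong E F (Star-map (λ {y} {z} e → trans (sym (E≡F y z)) e)) (Star-map (λ {y} {z} e → trans (E≡F y z) e))

  module _ (E : Graph N) (E-sym : Symmetric E) where

    private
      leastInComponent : ∀ a → Σ (Fin N) λ r →
        component E a r ≡ true × (∀ w → component E a w ≡ true → toℕ r ≤ toℕ w)
      leastInComponent a = least (component E a) a (reach⇒component E a a ε)

    leastOf : Fin N → Fin N
    leastOf a = proj₁ (leastInComponent a)

    reach-leastOf : ∀ a → Reach E a (leastOf a)
    reach-leastOf a = component⇒reach E a _ (proj₁ (proj₂ (leastInComponent a)))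

    leastOf-≤ : ∀ a w → Reach E a w → toℕ (leastOf a) ≤ toℕ w
    leastOf-≤ a w p = proj₂ (proj₂ (leastInComponent a)) w (reach⇒component E a w p)

    leastOf-least : ∀ a → IsLeast E (leastOf a)
    leastOf-least a w p = leastOf-≤ a w (reach-leastOf a ◅◅ p)

    least-unique : ∀ {v a} → IsLeast E v → Reach E v a → v ≡ leastOf a
    least-unique {v} {a} v-least v⇝a = toℕ-injective (≤-antisym
      (v-least _ (v⇝a ◅◅ reach-leastOf a)) (leastOf-≤ a v (reverse E-sym v⇝a)))

    #components-addEdge-connected : ∀ a b → Reach E a b → #components (addEdge a b E) ≡ #components E
    #components-addEdge-connected a b a⇝b = #components-cong _ _ shortcut (Star-map (⊆-addEdge a b E))
      where
      shortcut : ∀ {x y} → Reach (addEdge a b E) x y → Reach E x y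
      shortcut p with reach-addEdge a b E p
      ... | inj₁ q              = q
      ... | inj₂ (inj₁ (q , r)) = q ◅◅ a⇝b ◅◅ r
      ... | inj₂ (inj₂ (q , r)) = q ◅◅ reverse E-sym a⇝b ◅◅ r

    -- Joining two components loses exactly one least vertex: the larger of the two.
    private
      #components-join : ∀ a b → toℕ (leastOf a) < toℕ (leastOf b) →
                         #components E ≡ suc (#components (addEdge a b E))
      #components-join a b ra<rb = begin
        card (isRep E)                             ≡⟨ card-∖ (isRep E) rb ⟩
        card (isRep E ∖ rb) + ind (isRep E rb)     ≡⟨ cong₂ _+_ (count-cong same (allFin N))
                                                             (cong ind (isRep-complete E rb (leastOf-least b))) ⟩
        card (isRep E′) + 1                        ≡⟨ +-comm _ 1 ⟩
        suc (card (isRep E′))                      ∎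
        where
        open ≡-Reasoning
        E′ = addEdge a b E
        ra = leastOf a
        rb = leastOf b
        rb⇝′ra : Reach E′ rb ra
        rb⇝′ra = Star-map (⊆-addEdge a b E) (reverse E-sym (reach-leastOf b))
              ◅◅ addEdge-ba a b E ◅ Star-map (⊆-addEdge a b E) (reach-leastOf a)
        survives : ∀ y → y ≢ rb → IsLeast E y → IsLeast E′ y
        survives y y≢rb y-least w p with reach-addEdge a b E p
        ... | inj₁ q = y-least w q
        ... | inj₂ (inj₁ (y⇝a , b⇝w)) = ≤-trans (≤-reflexive (cong toℕ (least-unique y-least y⇝a)))
                                          (≤-trans (<⇒≤ ra<rb) (leastOf-≤ b w b⇝w))
        ... | inj₂ (inj₂ (y⇝b , _)) = ⊥-elim (y≢rb (least-unique y-least y⇝b))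
        rb-merged : isRep E′ rb ≡ false
        rb-merged with isRep E′ rb in e
        ... | false = refl
        ... | true  = ⊥-elim (<⇒≱ ra<rb (isRep-sound E′ rb e ra rb⇝′ra))
        same : ∀ y → (isRep E ∖ rb) y ≡ isRep E′ y
        same y with y ≟ rb
        ... | yes refl = sym rb-merged
        ... | no y≢rb = ≡true-ext
              (λ e → isRep-complete E′ y (survives y y≢rb (isRep-sound E y e)))
              (λ e → isRep-complete E y (λ w → isRep-sound E′ y e w ∘ Star-map (⊆-addEdge a b E)))

    #components-addEdge-disconnected : ∀ a b → ¬ Reach E a b → #components E ≡ suc (#components (addEdge a b E))
    #components-addEdge-disconnected a b a≁b with <-cmp (toℕ (leastOf a)) (toℕ (leastOf b))
    ... | tri< ra<rb _ _ = #components-join a b ra<rb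
    ... | tri> _ _ rb<ra = trans (#components-join b a rb<ra) (cong suc (#components-pointwise _ _ (addEdge-comm b a E)))
    ... | tri≈ _ ra≡rb _ = ⊥-elim (a≁b (reach-leastOf a ◅◅ subst (λ r → Reach E r b) (sym (toℕ-injective ra≡rb))
                                          (reverse E-sym (reach-leastOf b))))

    #components-addEdge-≤ : ∀ a b → #components (addEdge a b E) ≤ #components E
    #components-addEdge-≤ a b with reach? E a b
    ... | yes a⇝b = ≤-reflexive (#components-addEdge-connected a b a⇝b)
    ... | no  a≁b = ≤-trans (n≤1+n _) (≤-reflexive (sym (#components-addEdge-disconnected a b a≁b)))

    #components-≤-addEdge : ∀ a b → #components E ≤ suc (#components (addEdge a b E))
    #components-≤-addEdge a b with reach? E a b
    ... | yes a⇝b = ≤-trans (≤-reflexive (sym (#components-addEdge-connected a b a⇝b))) (n≤1+n _)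
    ... | no  a≁b = ≤-reflexive (#components-addEdge-disconnected a b a≁b)

-- Alternating cycles of a black matching m and a grey matching g

iter-+ : ∀ {A : Set} (f : A → A) i k x → iter (i + k) f x ≡ iter i f (iter k f x)
iter-+ f zero    k x = refl
iter-+ f (suc i) k x = cong f (iter-+ f i k x)

iter-suc : ∀ {A : Set} (f : A → A) k x → iter k f (f x) ≡ iter (suc k) f x
iter-suc f zero    x = refl
iter-suc f (suc k) x = cong f (iter-suc f k x)

iter-injective : ∀ {A : Set} (f : A → A) → Injective _≡_ _≡_ f → ∀ k → Injective _≡_ _≡_ (iter k f)
iter-injective f f-inj zero    e = e
iter-injective f f-inj (suc k) e = iter-injective f f-inj k (f-inj e)

-- The orbit of x under f cannot have N + 1 distinct points, so some iterate returns to x.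
injective-periodic : ∀ {N} (f : Fin N → Fin N) → Injective _≡_ _≡_ f →
                     ∀ x → ∃ λ d → iter (suc d) f x ≡ x
injective-periodic {N} f f-inj x with pigeonhole (n<1+n N) (λ i → iter (toℕ i) f x)
... | i , j , i<j , fⁱx≡fʲx with m≤n⇒∃[o]m+o≡n i<j
... | d , i+1+d≡j = d , sym (iter-injective f f-inj (toℕ i) (begin
  iter (toℕ i) f x                    ≡⟨ fⁱx≡fʲx ⟩
  iter (toℕ j) f x                    ≡⟨ cong (λ k → iter k f x) (trans (sym i+1+d≡j) (sym (+-suc (toℕ i) d))) ⟩
  iter (toℕ i + suc d) f x            ≡⟨ iter-+ f (toℕ i) (suc d) x ⟩
  iter (toℕ i) f (iter (suc d) f x)   ∎))
  where open ≡-Reasoning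

module AlternatingCycle {N : ℕ} (m g : Fin N → Fin N)
  (m-invol : ∀ x → m (m x) ≡ x) (m-nofix : ∀ x → m x ≢ x)
  (g-invol : ∀ x → g (g x) ≡ x) (g-nofix : ∀ x → g x ≢ x) where

  q : Fin N → Fin N
  q y = m (g y)

  g∘m∘q : ∀ y → g (m (q y)) ≡ y
  g∘m∘q y = trans (cong g (m-invol (g y))) (g-invol y)

  q-injective : Injective _≡_ _≡_ q
  q-injective {x} {y} e = trans (sym (g∘m∘q x)) (trans (cong (g ∘ m) e) (g∘m∘q y))

  q∘g∘q : ∀ y → q (g (q y)) ≡ g y
  q∘g∘q y = trans (cong m (g-invol (q y))) (m-invol (g y))

  -- The cycle alternates colours, so an even number of steps never lands on the grey partner.
  qᵏ≢g : ∀ k y → iter k q y ≢ g y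
  qᵏ≢g zero          y e = g-nofix y (sym e)
  qᵏ≢g (suc zero)    y e = m-nofix (g y) e
  qᵏ≢g (suc (suc k)) y e = qᵏ≢g k (q y) (begin
    iter k q (q y)    ≡⟨ iter-suc q k y ⟩
    iter (suc k) q y  ≡⟨ q-injective (trans e (sym (q∘g∘q y))) ⟩
    g (q y)           ∎)
    where open ≡-Reasoning

  module _ (E : Graph N) (a : Fin N) (g-arc : ∀ y → Arc E y (g y))
           (m-arc : ∀ y → y ≢ a → y ≢ m a → Arc E y (m y)) where

    walk : ∀ k → Reach E a (iter k q a) ⊎ Reach E a (m a)
    walk zero = inj₁ ε
    walk (suc k) with walk k
    ... | inj₂ a⇝ma = inj₂ a⇝ma
    ... | inj₁ a⇝y with g (iter k q a) ≟ m a | g (iter k q a) ≟ a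
    ... | yes gy≡ma | _ = inj₂ (a⇝y ◅◅ return (subst (Arc E _) gy≡ma (g-arc _)))
    ... | no _ | yes gy≡a = ⊥-elim (qᵏ≢g k a (trans (sym (g-invol _)) (cong g gy≡a)))
    ... | no gy≢ma | no gy≢a = inj₁ (a⇝y ◅◅ g-arc _ ◅ return (m-arc _ gy≢a gy≢ma))

    -- Removing the black edge at a from an alternating cycle leaves a and m a connected.
    alternating-cycle : Reach E a (m a)
    alternating-cycle with injective-periodic q q-injective a
    ... | d , qᵈ⁺¹a≡a with walk d
    ... | inj₂ a⇝ma = a⇝ma
    ... | inj₁ a⇝y = a⇝y ◅◅ return (subst (Arc E _) gy≡ma (g-arc _))
      where
      gy≡ma : g (iter d q a) ≡ m a
      gy≡ma = trans (sym (m-invol _)) (cong m qᵈ⁺¹a≡a)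

data Even : ℕ → Set where
  zero : Even 0
  2+   : ∀ {M} → Even M → Even (suc (suc M))

even-2+2* : ∀ n → Even (2 + 2 * n)
even-2+2* n = 2+ (subst Even (sym (cong (n +_) (+-identityʳ n))) (even-+ n))
  where
  even-+ : ∀ k → Even (k + k)
  even-+ zero    = zero
  even-+ (suc k) = subst Even (cong suc (sym (+-suc k k))) (2+ (even-+ k))

grey : ∀ {M} → Fin M → Fin M
grey {suc zero}    zero          = zero
grey {suc (suc M)} zero          = suc zero
grey {suc (suc M)} (suc zero)    = zero
grey {suc (suc M)} (suc (suc k)) = suc (suc (grey k))

greyℕ-2+ : ∀ k → greyℕ (suc (suc k)) ≡ suc (suc (greyℕ k))
greyℕ-2+ zero = refl
greyℕ-2+ (suc k) with suc k % 2 ≡ᵇ 0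
... | true  = refl
... | false = refl

toℕ-grey : ∀ {M} → Even M → (y : Fin M) → toℕ (grey y) ≡ greyℕ (toℕ y)
toℕ-grey (2+ ev) zero          = refl
toℕ-grey (2+ ev) (suc zero)    = refl
toℕ-grey (2+ ev) (suc (suc k)) = trans (cong (λ t → suc (suc t)) (toℕ-grey ev k)) (sym (greyℕ-2+ (toℕ k)))

grey-invol : ∀ {M} → Even M → (y : Fin M) → grey (grey y) ≡ y
grey-invol (2+ ev) zero          = refl
grey-invol (2+ ev) (suc zero)    = refl
grey-invol (2+ ev) (suc (suc k)) = cong (λ t → suc (suc t)) (grey-invol ev k)

grey-nofix : ∀ {M} → Even M → (y : Fin M) → grey y ≢ y
grey-nofix (2+ ev) zero          ()
grey-nofix (2+ ev) (suc zero)    ()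
grey-nofix (2+ ev) (suc (suc k)) e = grey-nofix ev k (suc-injective (suc-injective e))

-- The breakpoint graph of a genome

module _ {n : ℕ} where

  greyV-invol : (y : V n) → grey (grey y) ≡ y
  greyV-invol = grey-invol (even-2+2* n)

  greyV-nofix : (y : V n) → grey y ≢ y
  greyV-nofix = grey-nofix (even-2+2* n)

  greyℕ-≡ᵇ : ∀ (y z : V n) → (toℕ z ≡ᵇ greyℕ (toℕ y)) ≡ (z == grey y)
  greyℕ-≡ᵇ y z = ≡true-ext
    (λ e → ≡⇒== (toℕ-injective (trans (≡ᵇ⇒≡ _ _ (subst T (sym e) _)) (sym (toℕ-grey (even-2+2* n) y)))))
    (λ e → T⇒≡true (≡⇒≡ᵇ _ _ (trans (cong toℕ (==⇒≡ e)) (toℕ-grey (even-2+2* n) y))))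

  isIdentity⇒≡grey : ∀ {G : Genome n} → IsIdentity G → ∀ y → m G y ≡ grey y
  isIdentity⇒≡grey G-id y = toℕ-injective (trans (G-id y) (sym (toℕ-grey (even-2+2* n) y)))

  module _ (K : Genome n) where

    m-flip : ∀ {a b} → m K a ≡ b → m K b ≡ a
    m-flip {a} refl = invol K a

    black-arc : ∀ y → Arc (adjBG K) y (m K y)
    black-arc y = ∨-trueˡ _ (==-refl (m K y))

    grey-arc : ∀ y → Arc (adjBG K) y (grey y)
    grey-arc y = ∨-trueʳ (m K y == grey y) (trans (greyℕ-≡ᵇ y (grey y)) (==-refl (grey y)))

    adjBG-arc : ∀ {y z} → Arc (adjBG K) y z → m K y ≡ z ⊎ grey y ≡ z
    adjBG-arc {y} {z} e with ∨-true e
    ... | inj₁ black = inj₁ (==⇒≡ black)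
    ... | inj₂ g     = inj₂ (sym (==⇒≡ (trans (sym (greyℕ-≡ᵇ y z)) g)))

    adjBG-sym : Symmetric (adjBG K)
    adjBG-sym e with adjBG-arc e
    ... | inj₁ refl = subst (Arc (adjBG K) _) (invol K _) (black-arc _)
    ... | inj₂ refl = subst (Arc (adjBG K) _) (greyV-invol _) (grey-arc _)

    -- A 1-cycle is a black edge that is also grey; it is counted at its lower end.
    isUnit : V n → Bool
    isUnit y = m K y == grey y ∧ (toℕ y <ᵇ toℕ (m K y))

    lowerEnd : ∀ y → Σ (V n) λ e → (e ≡ y ⊎ e ≡ m K y) × toℕ e < toℕ (m K e)
    lowerEnd y with <-cmp (toℕ y) (toℕ (m K y))
    ... | tri< y<my _ _ = y , inj₁ refl , y<my
    ... | tri> _ _ my<y = m K y , inj₂ refl , subst (λ t → toℕ (m K y) < toℕ t) (sym (invol K y)) my<y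
    ... | tri≈ _ y≡my _ = ⊥-elim (nofix K y (toℕ-injective (sym y≡my)))

    reach-black : ∀ {v e} y → Reach (adjBG K) v y → e ≡ y ⊎ e ≡ m K y → Reach (adjBG K) v e
    reach-black y v⇝y (inj₁ refl) = v⇝y
    reach-black y v⇝y (inj₂ refl) = v⇝y ◅◅ return (black-arc y)

    cycleLength≥2 : ∀ v → m K v ≢ grey v → 2 ≤ cycleLength K v
    cycleLength≥2 v mv≢gv = 2≤card counted e₁ e₂ (counts e₁ v⇝e₁ e₁<) (counts e₂ v⇝e₂ e₂<) e₂≢e₁
      where
      counted : V n → Bool
      counted u = component (adjBG K) v u ∧ (toℕ u <ᵇ toℕ (m K u))
      counts : ∀ u → Reach (adjBG K) v u → toℕ u < toℕ (m K u) → counted u ≡ true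
      counts u v⇝u u< = ∧-true⁺ (reach⇒component (adjBG K) v u v⇝u) (T⇒≡true (<⇒<ᵇ u<))
      e₁ = proj₁ (lowerEnd v)
      e₂ = proj₁ (lowerEnd (grey v))
      e₁∈ = proj₁ (proj₂ (lowerEnd v))
      e₂∈ = proj₁ (proj₂ (lowerEnd (grey v)))
      e₁< = proj₂ (proj₂ (lowerEnd v))
      e₂< = proj₂ (proj₂ (lowerEnd (grey v)))
      v⇝e₁ = reach-black v ε e₁∈
      v⇝e₂ = reach-black (grey v) (return (grey-arc v)) e₂∈
      -- the black edges at v and at grey v coincide only if m K v ≡ grey v
      e₂≢e₁ : e₂ ≢ e₁
      e₂≢e₁ e₂≡e₁ with e₁∈ | e₂∈
      ... | inj₁ e₁≡v  | inj₁ e₂≡gv  = greyV-nofix v (trans (sym e₂≡gv) (trans e₂≡e₁ e₁≡v))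
      ... | inj₁ e₁≡v  | inj₂ e₂≡mgv = mv≢gv (m-flip (trans (sym e₂≡mgv) (trans e₂≡e₁ e₁≡v)))
      ... | inj₂ e₁≡mv | inj₁ e₂≡gv  = mv≢gv (trans (sym e₁≡mv) (trans (sym e₂≡e₁) e₂≡gv))
      ... | inj₂ e₁≡mv | inj₂ e₂≡mgv = greyV-nofix v (trans (sym (invol K (grey v)))
                                         (trans (cong (m K) (trans (sym e₂≡mgv) (trans e₂≡e₁ e₁≡mv))) (invol K v)))

    unit-cycle : ∀ {E v w} → E ⊆ adjBG K → m K v ≡ grey v → Reach E v w → w ≡ v ⊎ w ≡ m K v
    unit-cycle {E} {v} E⊆K mv≡gv v⇝w = ends (closed-reach closed v⇝w (∨-trueˡ _ (==-refl v)))
      where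
      edge : V n → Bool
      edge y = y == v ∨ y == m K v
      ends : ∀ {y} → edge y ≡ true → y ≡ v ⊎ y ≡ m K v
      ends {y} e with ∨-true {y == v} e
      ... | inj₁ y≡v  = inj₁ (==⇒≡ y≡v)
      ... | inj₂ y≡mv = inj₂ (==⇒≡ y≡mv)
      at-v : edge v ≡ true
      at-v = ∨-trueˡ _ (==-refl v)
      at-mv : edge (m K v) ≡ true
      at-mv = ∨-trueʳ (m K v == v) (==-refl (m K v))
      closed : Closed E edge
      closed {u} eu a with ends {u} eu | adjBG-arc (E⊆K a)
      ... | inj₁ refl | inj₁ refl = at-mv
      ... | inj₁ refl | inj₂ refl = subst (λ t → edge t ≡ true) mv≡gv at-mv
      ... | inj₂ refl | inj₁ refl = subst (λ t → edge t ≡ true) (sym (invol K v)) at-v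
      ... | inj₂ refl | inj₂ refl = subst (λ t → edge t ≡ true) (sym (trans (cong grey mv≡gv) (greyV-invol v))) at-v

    isUnit-sound : ∀ v → isRep (adjBG K) v ∧ (cycleLength K v ≡ᵇ 1) ≡ true → isUnit v ≡ true
    isUnit-sound v e = ∧-true⁺ (≡⇒== mv≡gv) (T⇒≡true (<⇒<ᵇ v<mv))
      where
      rep = proj₁ (∧-true {isRep (adjBG K) v} e)
      length≡1 : cycleLength K v ≡ 1
      length≡1 = ≡ᵇ⇒≡ _ 1 (subst T (sym (proj₂ (∧-true {isRep (adjBG K) v} e))) _)
      mv≡gv : m K v ≡ grey v
      mv≡gv = decidable-stable (m K v ≟ grey v) λ mv≢gv →
        <-irrefl refl (≤-trans (cycleLength≥2 v mv≢gv) (≤-reflexive length≡1))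
      v<mv : toℕ v < toℕ (m K v)
      v<mv = ≤∧≢⇒< (isRep-sound (adjBG K) v rep (m K v) (return (black-arc v)))
                   (λ v≡mv → nofix K v (toℕ-injective (sym v≡mv)))

    isUnit-complete : ∀ v → isUnit v ≡ true → isRep (adjBG K) v ∧ (cycleLength K v ≡ᵇ 1) ≡ true
    isUnit-complete v e = ∧-true⁺ (isRep-complete (adjBG K) v v-least) (T⇒≡true (≡⇒≡ᵇ _ 1 length≡1))
      where
      mv≡gv : m K v ≡ grey v
      mv≡gv = ==⇒≡ (proj₁ (∧-true e))
      v<mv : toℕ v < toℕ (m K v)
      v<mv = <ᵇ⇒< _ _ (subst T (sym (proj₂ (∧-true {m K v == grey v} e))) _)
      v-least : IsLeast (adjBG K) v
      v-least w v⇝w with unit-cycle (λ a → a) mv≡gv v⇝w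
      ... | inj₁ refl = ≤-refl
      ... | inj₂ refl = <⇒≤ v<mv
      length≡1 : cycleLength K v ≡ 1
      length≡1 = card≡1 _ v (∧-true⁺ (reach⇒component (adjBG K) v v ε) (T⇒≡true (<⇒<ᵇ v<mv))) only-v
        where
        only-v : ∀ u → component (adjBG K) v u ∧ (toℕ u <ᵇ toℕ (m K u)) ≡ true → u ≡ v
        only-v u c with ∧-true {component (adjBG K) v u} c
        ... | v~u , u< with unit-cycle (λ a → a) mv≡gv (component⇒reach (adjBG K) v u v~u)
        ... | inj₁ u≡v = u≡v
        ... | inj₂ refl = ⊥-elim (<-asym v<mv (subst (λ t → toℕ (m K v) < toℕ t) (invol K v)
                                                 (<ᵇ⇒< _ _ (subst T (sym u<) _))))

    c1BG≡card-isUnit : c1BG K ≡ card isUnit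
    c1BG≡card-isUnit = count-cong (λ v → ≡true-ext (isUnit-sound v) (isUnit-complete v)) (allFin _)

==grey-sym : ∀ {n} (a b : V n) → (b == grey a) ≡ (a == grey b)
==grey-sym {n} a b = ≡true-ext (λ e → ≡⇒== (flip (==⇒≡ e))) (λ e → ≡⇒== (flip (==⇒≡ e)))
  where
  flip : ∀ {c d} → d ≡ grey c → c ≡ grey d
  flip {c} refl = sym (greyV-invol {n} c)

<ᵇ-exclusive : ∀ i j → i ≢ j → ind (i <ᵇ j) + ind (j <ᵇ i) ≡ 1
<ᵇ-exclusive zero    zero    i≢j = ⊥-elim (i≢j refl)
<ᵇ-exclusive zero    (suc j) _   = refl
<ᵇ-exclusive (suc i) zero    _   = refl
<ᵇ-exclusive (suc i) (suc j) i≢j = <ᵇ-exclusive i j (λ i≡j → i≢j (cong suc i≡j))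

isUnit-pair : ∀ {n} (K : Genome n) {a b} → m K a ≡ b →
              ind (isUnit K a) + ind (isUnit K b) ≡ ind (b == grey a)
isUnit-pair {n} K {a} {b} Kab = begin
  ind (isUnit K a) + ind (isUnit K b)
    ≡⟨ cong₂ (λ s t → ind s + ind t)
         (cong (λ c → (c == grey a) ∧ (toℕ a <ᵇ toℕ c)) Kab)
         (trans (cong (λ c → (c == grey b) ∧ (toℕ b <ᵇ toℕ c)) (m-flip K Kab))
                (cong (_∧ (toℕ b <ᵇ toℕ a)) (==grey-sym {n} b a))) ⟩
  ind ((b == grey a) ∧ (toℕ a <ᵇ toℕ b)) + ind ((b == grey a) ∧ (toℕ b <ᵇ toℕ a))
    ≡⟨ split (b == grey a) ⟩
  ind (b == grey a) ∎
  where
  open ≡-Reasoning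
  split : ∀ c → ind (c ∧ (toℕ a <ᵇ toℕ b)) + ind (c ∧ (toℕ b <ᵇ toℕ a)) ≡ ind c
  split false = refl
  split true  = <ᵇ-exclusive (toℕ a) (toℕ b) (λ a≡b → nofix K a (trans Kab (sym (toℕ-injective a≡b))))

module _ {n : ℕ} (K : Genome n) where

  addEdge-black : ∀ {a b} E → m K a ≡ b → ∀ {y} → y ≡ a ⊎ y ≡ b → Arc (addEdge a b E) y (m K y)
  addEdge-black E Kab (inj₁ refl) = subst (Arc (addEdge _ _ E) _) (sym Kab) (addEdge-ab _ _ E)
  addEdge-black E Kab (inj₂ refl) = subst (Arc (addEdge _ _ E) _) (sym (m-flip K Kab)) (addEdge-ba _ _ E)

  black-edge-arc : ∀ {a b y z} → m K a ≡ b → (y ≡ a × z ≡ b) ⊎ (y ≡ b × z ≡ a) → Arc (adjBG K) y z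
  black-edge-arc Kab (inj₁ (refl , refl)) = subst (Arc (adjBG K) _) Kab (black-arc K _)
  black-edge-arc Kab (inj₂ (refl , refl)) = subst (Arc (adjBG K) _) (m-flip K Kab) (black-arc K _)

  module _ (S : Graph (2 + 2 * n)) (S-grey : ∀ y → Arc S y (grey y)) where

    cBG-decompose : ∀ {a b c d} → m K a ≡ b → m K c ≡ d →
      (∀ y → y ≢ a → y ≢ b → y ≢ c → y ≢ d → Arc S y (m K y)) → S ⊆ adjBG K →
      cBG K ≡ #components (addEdge c d (addEdge a b S))
    cBG-decompose {a} {b} {c} {d} Kab Kcd S-black S⊆K =
      #components-cong (adjBG K) S′ (Star-map K⊆) (Star-map ⊆K)
      where
      S′ = addEdge c d (addEdge a b S)
      lift : addEdge a b S ⊆ S′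
      lift = ⊆-addEdge c d (addEdge a b S)
      black : ∀ y → Dec (y ≡ a) → Dec (y ≡ b) → Dec (y ≡ c) → Dec (y ≡ d) → Arc S′ y (m K y)
      black y (yes y≡a) _ _ _ = lift (addEdge-black S Kab (inj₁ y≡a))
      black y _ (yes y≡b) _ _ = lift (addEdge-black S Kab (inj₂ y≡b))
      black y _ _ (yes y≡c) _ = addEdge-black (addEdge a b S) Kcd (inj₁ y≡c)
      black y _ _ _ (yes y≡d) = addEdge-black (addEdge a b S) Kcd (inj₂ y≡d)
      black y (no y≢a) (no y≢b) (no y≢c) (no y≢d) = lift (⊆-addEdge a b S (S-black y y≢a y≢b y≢c y≢d))
      K⊆ : adjBG K ⊆ S′
      K⊆ e with adjBG-arc K e
      ... | inj₁ refl = black _ (_ ≟ a) (_ ≟ b) (_ ≟ c) (_ ≟ d)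
      ... | inj₂ refl = lift (⊆-addEdge a b S (S-grey _))
      ⊆K : S′ ⊆ adjBG K
      ⊆K {y} {z} e with addEdge-arc c d (addEdge a b S) {y} {z} e
      ... | inj₂ cd = black-edge-arc Kcd cd
      ... | inj₁ e′ with addEdge-arc a b S {y} {z} e′
      ...   | inj₁ e″ = S⊆K e″
      ...   | inj₂ ab = black-edge-arc Kab ab

    reach-across : ∀ {a b} c → m K a ≡ b →
      (∀ y → y ≢ a → y ≢ b → y ≢ c → y ≢ m K c → Arc S y (m K y)) →
      Reach (addEdge a b S) c (m K c)
    reach-across {a} {b} c Kab S-black =
      AlternatingCycle.alternating-cycle (m K) grey (invol K) (nofix K) (greyV-invol {n}) (greyV-nofix {n})
        (addEdge a b S) c (λ y → ⊆-addEdge a b S (S-grey y)) (λ y → black y (y ≟ a) (y ≟ b))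
      where
      black : ∀ y → Dec (y ≡ a) → Dec (y ≡ b) → y ≢ c → y ≢ m K c → Arc (addEdge a b S) y (m K y)
      black y (yes y≡a) _ _ _ = addEdge-black S Kab (inj₁ y≡a)
      black y _ (yes y≡b) _ _ = addEdge-black S Kab (inj₂ y≡b)
      black y (no y≢a) (no y≢b) y≢c y≢mc = ⊆-addEdge a b S (S-black y y≢a y≢b y≢c y≢mc)

record DCJ {n : ℕ} (G H : Genome n) (u v w x : V n) : Set where
  field
    G-uv : m G u ≡ v
    G-wx : m G w ≡ x
    H-uw : m H u ≡ w
    H-vx : m H v ≡ x
    u≢w  : u ≢ w
    u≢x  : u ≢ x
    unchanged : ∀ y → y ≢ u → y ≢ v → y ≢ w → y ≢ x → m H y ≡ m G y

module _ {n : ℕ} {G H : Genome n} where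

  DCJ-swapEnds : ∀ {u v w x} → DCJ G H u v w x → DCJ G H v u x w
  DCJ-swapEnds {u} {v} {w} {x} d = record
    { G-uv = m-flip G G-uv
    ; G-wx = m-flip G G-wx
    ; H-uw = H-vx
    ; H-vx = H-uw
    ; u≢w  = λ v≡x → u≢w (trans (sym (m-flip G G-uv)) (trans (cong (m G) v≡x) (m-flip G G-wx)))
    ; u≢x  = λ v≡w → u≢x (trans (sym (m-flip G G-uv)) (trans (cong (m G) v≡w) G-wx))
    ; unchanged = λ y y≢v y≢u y≢x y≢w → unchanged y y≢u y≢v y≢w y≢x
    }
    where open DCJ d

  DCJ-swapEdges : ∀ {u v w x} → DCJ G H u v w x → DCJ G H w x u v
  DCJ-swapEdges {u} {v} {w} {x} d = record
    { G-uv = G-wx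
    ; G-wx = G-uv
    ; H-uw = m-flip H H-uw
    ; H-vx = m-flip H H-vx
    ; u≢w  = λ w≡u → u≢w (sym w≡u)
    ; u≢x  = λ w≡v → u≢x (trans (sym (m-flip H H-uw)) (trans (cong (m H) w≡v) H-vx))
    ; unchanged = λ y y≢w y≢x y≢u y≢v → unchanged y y≢u y≢v y≢w y≢x
    }
    where open DCJ d

module _ {n : ℕ} {G H : Genome n} {u v w x : V n} (d : DCJ G H u v w x) where
  open DCJ d

  v≢u : v ≢ u
  v≢u v≡u = nofix G u (trans G-uv v≡u)

  w≢v : w ≢ v
  w≢v w≡v = u≢x (trans (sym (m-flip G G-uv)) (trans (cong (m G) (sym w≡v)) G-wx))

  x≢v : x ≢ v
  x≢v x≡v = u≢w (trans (sym (m-flip G G-uv)) (trans (cong (m G) (sym x≡v)) (m-flip G G-wx)))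

  x≢w : x ≢ w
  x≢w x≡w = nofix G w (trans G-wx x≡w)

  common : Graph (2 + 2 * n)
  common y z = adjBG G y z ∧ adjBG H y z

  common-⊆G : common ⊆ adjBG G
  common-⊆G e = proj₁ (∧-true e)

  common-⊆H : common ⊆ adjBG H
  common-⊆H {y} {z} e = proj₂ (∧-true {adjBG G y z} e)

  common-sym : Symmetric common
  common-sym e = ∧-true⁺ (adjBG-sym G (common-⊆G e)) (adjBG-sym H (common-⊆H e))

  common-grey : ∀ y → Arc common y (grey y)
  common-grey y = ∧-true⁺ (grey-arc G y) (grey-arc H y)

  common-black : ∀ y → y ≢ u → y ≢ v → y ≢ w → y ≢ x → Arc common y (m G y)
  common-black y y≢u y≢v y≢w y≢x =
    ∧-true⁺ (black-arc G y) (subst (Arc (adjBG H) y) (unchanged y y≢u y≢v y≢w y≢x) (black-arc H y))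

  common-blackH : ∀ y → y ≢ u → y ≢ v → y ≢ w → y ≢ x → Arc common y (m H y)
  common-blackH y y≢u y≢v y≢w y≢x =
    subst (Arc common y) (sym (unchanged y y≢u y≢v y≢w y≢x)) (common-black y y≢u y≢v y≢w y≢x)

  cBG-G : cBG G ≡ #components (addEdge w x (addEdge u v common))
  cBG-G = cBG-decompose G common common-grey G-uv G-wx common-black common-⊆G

  cBG-H : cBG H ≡ #components (addEdge u w (addEdge v x common))
  cBG-H = cBG-decompose H common common-grey H-vx H-uw
    (λ y y≢v y≢x y≢u y≢w → common-blackH y y≢u y≢v y≢w y≢x) common-⊆H

  -- {u,w} closes a cycle of BG(H) through {v,x}, so adding it last does not merge components.
  cBG-H-without-uw : cBG H ≡ #components (addEdge v x common)
  cBG-H-without-uw = trans cBG-H (#components-addEdge-connected (addEdge v x common)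
    (addEdge-sym v x common common-sym) u w
    (subst (Reach (addEdge v x common) u) H-uw
      (reach-across H common common-grey u H-vx (λ y y≢v y≢x y≢u y≢mu →
         common-blackH y y≢u y≢v (λ y≡w → y≢mu (trans y≡w (sym H-uw))) y≢x))))

  cBG-≤-suc : cBG G ≤ suc (cBG H)
  cBG-≤-suc = begin
    cBG G                                              ≡⟨ cBG-G ⟩
    #components (addEdge w x (addEdge u v common))     ≤⟨ #components-addEdge-≤ _ (addEdge-sym u v common common-sym) w x ⟩
    #components (addEdge u v common)                   ≤⟨ #components-addEdge-≤ common common-sym u v ⟩
    #components common                                 ≤⟨ #components-≤-addEdge common common-sym v x ⟩
    suc (#components (addEdge v x common))             ≡⟨ cong suc cBG-H-without-uw ⟨
    suc (cBG H)                                        ∎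
    where open ≤-Reasoning

  -- If {v,x} becomes a 1-cycle, it is split off from the cycle through u.
  cBG-split : x ≡ grey v → cBG G < cBG H
  cBG-split x≡gv = begin-strict
    cBG G                                              ≡⟨ cBG-G ⟩
    #components (addEdge w x (addEdge u v common))     ≤⟨ #components-addEdge-≤ _ (addEdge-sym u v common common-sym) w x ⟩
    #components (addEdge u v common)                   <⟨ n<1+n _ ⟩
    suc (#components (addEdge u v common))             ≡⟨ #components-addEdge-disconnected common common-sym u v u≁v ⟨
    #components common                                 ≡⟨ #components-addEdge-connected common common-sym v x v⇝x ⟨
    #components (addEdge v x common)                   ≡⟨ cBG-H-without-uw ⟨
    cBG H                                              ∎
    where
    open ≤-Reasoning
    v⇝x : Reach common v x
    v⇝x = subst (Reach common v) (sym x≡gv) (return (common-grey v))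
    u≁v : ¬ Reach common u v
    u≁v u⇝v with unit-cycle H common-⊆H (trans H-vx x≡gv) (reverse common-sym u⇝v)
    ... | inj₁ u≡v = v≢u (sym u≡v)
    ... | inj₂ u≡mv = u≢x (trans u≡mv H-vx)

  w≢u : w ≢ u
  w≢u w≡u = u≢w (sym w≡u)

  x≢u : x ≢ u
  x≢u x≡u = u≢x (sym x≡u)

  -- the 1-cycles of G away from the four endpoints, which are also those of H
  untouched : V n → Bool
  untouched = (((isUnit G ∖ u) ∖ v) ∖ w) ∖ x

  c1BG-G : c1BG G ≡ card untouched + (ind (v == grey u) + ind (x == grey w))
  c1BG-G = begin
    c1BG G                                                            ≡⟨ c1BG≡card-isUnit G ⟩
    card (isUnit G)                                                   ≡⟨ card-∖₄ (isUnit G) v≢u w≢u w≢v x≢u x≢v x≢w ⟩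
    card untouched + (iu + iv + iw + ix)                              ≡⟨ cong (card untouched +_) (+-assoc (iu + iv) iw ix) ⟩
    card untouched + ((iu + iv) + (iw + ix))                          ≡⟨ cong₂ (λ s t → card untouched + (s + t))
                                                                           (isUnit-pair G G-uv) (isUnit-pair G G-wx) ⟩
    card untouched + (ind (v == grey u) + ind (x == grey w))          ∎
    where
    open ≡-Reasoning
    iu = ind (isUnit G u)
    iv = ind (isUnit G v)
    iw = ind (isUnit G w)
    ix = ind (isUnit G x)

  c1BG-H : c1BG H ≡ card untouched + (ind (w == grey u) + ind (x == grey v))
  c1BG-H = begin
    c1BG H                                                            ≡⟨ c1BG≡card-isUnit H ⟩
    card (isUnit H)                                                   ≡⟨ card-∖₄ (isUnit H) v≢u w≢u w≢v x≢u x≢v x≢w ⟩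
    card ((((isUnit H ∖ u) ∖ v) ∖ w) ∖ x) + (iu + iv + iw + ix)       ≡⟨ cong (_+ (iu + iv + iw + ix))
                                                                           (count-cong (∖₄-cong u v w x same-off) (allFin _)) ⟨
    card untouched + (iu + iv + iw + ix)                              ≡⟨ cong (card untouched +_) (rearrange iu iv iw ix) ⟩
    card untouched + ((iu + iw) + (iv + ix))                          ≡⟨ cong₂ (λ s t → card untouched + (s + t))
                                                                           (isUnit-pair H H-uw) (isUnit-pair H H-vx) ⟩
    card untouched + (ind (w == grey u) + ind (x == grey v))          ∎
    where
    open ≡-Reasoning
    iu = ind (isUnit H u)
    iv = ind (isUnit H v)
    iw = ind (isUnit H w)
    ix = ind (isUnit H x)
    same-off : ∀ y → y ≢ u → y ≢ v → y ≢ w → y ≢ x → isUnit G y ≡ isUnit H y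
    same-off y y≢u y≢v y≢w y≢x =
      cong (λ z → (z == grey y) ∧ (toℕ y <ᵇ toℕ z)) (sym (unchanged y y≢u y≢v y≢w y≢x))
    rearrange : ∀ a b c e → a + b + c + e ≡ (a + c) + (b + e)
    rearrange = solve-∀

-- A prefix DCJ changes c - 2 c₁ - (0 or 2) by at most one

penalty : Bool → ℕ
penalty b = if b then 0 else 2

deficit : ∀ {n} → Genome n → ℕ
deficit K = 2 * c1BG K + penalty (zeroOneEdge K)

zeroOneEdge≡ : ∀ {n} (K : Genome n) → zeroOneEdge K ≡ (m K zero == grey zero)
zeroOneEdge≡ {n} K = greyℕ-≡ᵇ {n} zero (m K zero)

-- With u = 0 the penalty cancels the indicator of the 1-cycle at 0 in 2 c₁.
deficit-form : ∀ A b c → 2 * (A + (ind b + ind c)) + penalty b ≡ 2 + 2 * A + 2 * ind c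
deficit-form A true  c = lemma A (ind c)
  where
  lemma : ∀ a i → 2 * (a + (1 + i)) + 0 ≡ 2 + 2 * a + 2 * i
  lemma = solve-∀
deficit-form A false c = lemma A (ind c)
  where
  lemma : ∀ a i → 2 * (a + (0 + i)) + 2 ≡ 2 + 2 * a + 2 * i
  lemma = solve-∀

module _ {n : ℕ} {G H : Genome n} {v w x : V n} (d : DCJ G H zero v w x) where
  open DCJ d

  cBG-+-unit-≤ : cBG G + 2 * ind (x == grey v) ≤ suc (cBG H)
  cBG-+-unit-≤ with x ≟ grey v
  ... | yes x≡gv = subst (_≤ suc (cBG H)) (+-comm 2 (cBG G)) (s≤s (cBG-split d x≡gv))
  ... | no _     = subst (_≤ suc (cBG H)) (sym (+-identityʳ (cBG G))) (cBG-≤-suc d)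

  deficit-G : deficit G ≡ 2 + 2 * card (untouched d) + 2 * ind (x == grey w)
  deficit-G = trans (cong₂ (λ c z → 2 * c + penalty z) (c1BG-G d) (trans (zeroOneEdge≡ G) (cong (_== grey zero) G-uv)))
                    (deficit-form (card (untouched d)) _ _)

  deficit-H : deficit H ≡ 2 + 2 * card (untouched d) + 2 * ind (x == grey v)
  deficit-H = trans (cong₂ (λ c z → 2 * c + penalty z) (c1BG-H d) (trans (zeroOneEdge≡ H) (cong (_== grey zero) H-uw)))
                    (deficit-form (card (untouched d)) _ _)

  dcj-step : cBG G + deficit H ≤ suc (cBG H + deficit G)
  dcj-step = begin
    cBG G + deficit H                         ≡⟨ cong (cBG G +_) deficit-H ⟩
    cBG G + (B + 2 * ind (x == grey v))       ≡⟨ +-comm-middle (cBG G) B _ ⟩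
    (cBG G + 2 * ind (x == grey v)) + B       ≤⟨ +-monoˡ-≤ B cBG-+-unit-≤ ⟩
    suc (cBG H) + B                           ≤⟨ m≤m+n (suc (cBG H) + B) _ ⟩
    suc (cBG H) + B + 2 * ind (x == grey w)   ≡⟨ cong suc (+-assoc (cBG H) B _) ⟩
    suc (cBG H + (B + 2 * ind (x == grey w))) ≡⟨ cong (λ t → suc (cBG H + t)) deficit-G ⟨
    suc (cBG H + deficit G)                   ∎
    where
    open ≤-Reasoning
    B = 2 + 2 * card (untouched d)
    +-comm-middle : ∀ a b c → a + (b + c) ≡ (a + c) + b
    +-comm-middle = solve-∀

toℕ≡0 : ∀ {N} {a : Fin (suc N)} → toℕ a ≡ 0 → a ≡ zero
toℕ≡0 {a = zero} _ = refl

prefixDCJ-step : ∀ {n} {G H : Genome n} → PrefixDCJ G H → cBG G + deficit H ≤ suc (cBG H + deficit G)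
prefixDCJ-step {G = G} {H} (u , v , w , x , G-uv , G-wx , u≢w , u≢x , at-zero , H-uw , H-vx , unchanged) =
  by-end-at-zero at-zero
  where
  d : DCJ G H u v w x
  d = record { G-uv = G-uv ; G-wx = G-wx ; H-uw = H-uw ; H-vx = H-vx ; u≢w = u≢w ; u≢x = u≢x
             ; unchanged = unchanged }
  step-at : ∀ {a b c e} → a ≡ zero → DCJ G H a b c e → cBG G + deficit H ≤ suc (cBG H + deficit G)
  step-at refl = dcj-step
  by-end-at-zero : toℕ u ≡ 0 ⊎ toℕ v ≡ 0 ⊎ toℕ w ≡ 0 ⊎ toℕ x ≡ 0 →
                   cBG G + deficit H ≤ suc (cBG H + deficit G)
  by-end-at-zero (inj₁ u≡0)               = step-at (toℕ≡0 u≡0) d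
  by-end-at-zero (inj₂ (inj₁ v≡0))        = step-at (toℕ≡0 v≡0) (DCJ-swapEnds d)
  by-end-at-zero (inj₂ (inj₂ (inj₁ w≡0))) = step-at (toℕ≡0 w≡0) (DCJ-swapEdges d)
  by-end-at-zero (inj₂ (inj₂ (inj₂ x≡0))) = step-at (toℕ≡0 x≡0) (DCJ-swapEnds (DCJ-swapEdges d))

lowerGrey : ∀ {M} → Fin M → Bool
lowerGrey y = toℕ y <ᵇ toℕ (grey y)

card-lowerGrey : ∀ {M} → Even M → 2 * card (lowerGrey {M}) ≡ M
card-lowerGrey zero = refl
card-lowerGrey {suc (suc M)} (2+ ev)
  rewrite count-∷ (lowerGrey {suc (suc M)}) zero (tabulate suc)
        | count-∷ (lowerGrey {suc (suc M)}) (suc zero) (tabulate (λ k → suc (suc k)))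
        | count-tabulate (λ k → suc (suc k)) (lowerGrey {suc (suc M)}) =
  trans (lemma (card (lowerGrey {M}))) (cong (λ t → suc (suc t)) (card-lowerGrey ev))
  where
  lemma : ∀ c → 2 * (1 + (0 + c)) ≡ 2 + 2 * c
  lemma = solve-∀

module _ {n : ℕ} {G : Genome n} (G-id : IsIdentity G) where

  private
    G≡grey : ∀ y → m G y ≡ grey y
    G≡grey = isIdentity⇒≡grey {G = G} G-id

  identity-zeroOneEdge : zeroOneEdge G ≡ true
  identity-zeroOneEdge = trans (zeroOneEdge≡ G) (≡⇒== (G≡grey zero))

  identity-c1BG : c1BG G ≡ n + 1
  identity-c1BG = *-cancelˡ-≡ (c1BG G) (n + 1) 2 (begin
    2 * c1BG G             ≡⟨ cong (2 *_) (c1BG≡card-isUnit G) ⟩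
    2 * card (isUnit G)    ≡⟨ cong (2 *_) (count-cong isUnit≡lowerGrey (allFin (2 + 2 * n))) ⟩
    2 * card (lowerGrey {2 + 2 * n}) ≡⟨ card-lowerGrey (even-2+2* n) ⟩
    2 + 2 * n              ≡⟨ lemma n ⟩
    2 * (n + 1)            ∎)
    where
    open ≡-Reasoning
    isUnit≡lowerGrey : ∀ y → isUnit G y ≡ lowerGrey y
    isUnit≡lowerGrey y rewrite G≡grey y | ==-refl (grey y) = refl
    lemma : ∀ k → 2 + 2 * k ≡ 2 * (k + 1)
    lemma = solve-∀

  identity-cBG≤c1BG : cBG G ≤ c1BG G
  identity-cBG≤c1BG = subst (cBG G ≤_) (sym (c1BG≡card-isUnit G)) (count-mono rep⇒unit (allFin _))
    where
    rep⇒unit : ∀ v → isRep (adjBG G) v ≡ true → isUnit G v ≡ true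
    rep⇒unit v rep = ∧-true⁺ (≡⇒== (G≡grey v)) (T⇒≡true (<⇒<ᵇ (subst (λ t → toℕ v < toℕ t) (sym (G≡grey v))
      (≤∧≢⇒< (isRep-sound (adjBG G) v rep (grey v) (return (grey-arc G v)))
             (λ v≡gv → greyV-nofix {n} v (toℕ-injective (sym v≡gv)))))))

  identity-bound : n + 1 + cBG G ≤ deficit G
  identity-bound = begin
    n + 1 + cBG G         ≤⟨ +-monoʳ-≤ (n + 1) (≤-trans identity-cBG≤c1BG (≤-reflexive identity-c1BG)) ⟩
    n + 1 + (n + 1)       ≡⟨ lemma (n + 1) ⟩
    2 * (n + 1) + 0       ≡⟨ cong₂ (λ c z → 2 * c + penalty z) identity-c1BG identity-zeroOneEdge ⟨
    deficit G             ∎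
    where
    open ≤-Reasoning
    lemma : ∀ k → k + k ≡ 2 * k + 0
    lemma = solve-∀

potential-step : ∀ a cG cH dG dH k → cG + dH ≤ suc (cH + dG) → a + cH ≤ k + dH → a + cG ≤ suc k + dG
potential-step a cG cH dG dH k one-step ih = +-cancelʳ-≤ dH (a + cG) (suc k + dG) (begin
  a + cG + dH          ≡⟨ +-assoc a cG dH ⟩
  a + (cG + dH)        ≤⟨ +-monoʳ-≤ a one-step ⟩
  a + suc (cH + dG)    ≡⟨ lemma₁ a cH dG ⟩
  suc (a + cH + dG)    ≤⟨ s≤s (+-monoˡ-≤ dG ih) ⟩
  suc (k + dH + dG)    ≡⟨ lemma₂ k dH dG ⟩
  suc k + dG + dH      ∎)
  where
  open ≤-Reasoning
  lemma₁ : ∀ a c d → a + suc (c + d) ≡ suc (a + c + d)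
  lemma₁ = solve-∀
  lemma₂ : ∀ k e d → suc (k + e + d) ≡ suc k + d + e
  lemma₂ = solve-∀

psortable-bound : ∀ {n} {G : Genome n} {k} → PSortable G k → n + 1 + cBG G ≤ k + deficit G
psortable-bound {G = G} (done G-id) = identity-bound {G = G} G-id
psortable-bound {n} {G} (step {H = H} {k = k} dcj rest) =
  potential-step (n + 1) (cBG G) (cBG H) (deficit G) (deficit H) k (prefixDCJ-step {G = G} {H} dcj) (psortable-bound rest)

⊖-≤ : ∀ a b d → a ≤ d + b → a ⊖ b ℤ.≤ ℤ.+ d
⊖-≤ a b d a≤d+b = ℤ.≤-trans (ℤ.⊖-monoˡ-≤ b a≤d+b) (ℤ.≤-reflexive (begin
  (d + b) ⊖ b     ≡⟨ ℤ.⊖-≥ (m≤n+m b d) ⟩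
  ℤ.+ (d + b ∸ b) ≡⟨ cong ℤ.+_ (m+n∸n≡m d b) ⟩
  ℤ.+ d           ∎))
  where open ≡-Reasoning

lowerBound-form : ∀ a c e z → ℤ.+ a ℤ.+ ℤ.+ c ℤ.- ℤ.+ 2 ℤ.* ℤ.+ e ℤ.- (if z then ℤ.+ 0 else ℤ.+ 2)
                              ≡ (a + c) ⊖ (2 * e + penalty z)
lowerBound-form a c e z = begin
  ℤ.+ a ℤ.+ ℤ.+ c ℤ.- ℤ.+ 2 ℤ.* ℤ.+ e ℤ.- p       ≡⟨ reassociate (ℤ.+ a) (ℤ.+ c) (ℤ.+ e) p ⟩
  (ℤ.+ a ℤ.+ ℤ.+ c) ℤ.- (ℤ.+ 2 ℤ.* ℤ.+ e ℤ.+ p)   ≡⟨ cong₂ ℤ._-_ (ℤ.pos-+ a c) (cong₂ ℤ._+_ (ℤ.pos-* 2 e) penalty≡) ⟨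
  ℤ.+ (a + c) ℤ.- (ℤ.+ (2 * e) ℤ.+ ℤ.+ penalty z) ≡⟨ cong (λ t → ℤ.+ (a + c) ℤ.- t) (ℤ.pos-+ (2 * e) (penalty z)) ⟨
  ℤ.+ (a + c) ℤ.- ℤ.+ (2 * e + penalty z)         ≡⟨ ℤ.m-n≡m⊖n (a + c) (2 * e + penalty z) ⟩
  (a + c) ⊖ (2 * e + penalty z)                   ∎
  where
  open ≡-Reasoning
  p = if z then ℤ.+ 0 else ℤ.+ 2
  penalty≡ : ℤ.+ penalty z ≡ p
  penalty≡ = if-float ℤ.+_ z
  reassociate : ∀ (x y w q : ℤ) → x ℤ.+ y ℤ.- ℤ.+ 2 ℤ.* w ℤ.- q ≡ (x ℤ.+ y) ℤ.- (ℤ.+ 2 ℤ.* w ℤ.+ q)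
  reassociate = ℤ-solve-∀

theorem2 : ∀ (n : ℕ) (G : Genome n) → Linear G →
    ∀ (d : ℕ) → PsdcjIs G d → lowerBound G ℤ.≤ ℤ.+ d
theorem2 n G _ d (sorts-in-d , _) =
  subst (ℤ._≤ ℤ.+ d) (sym (lowerBound-form (n + 1) (cBG G) (c1BG G) (zeroOneEdge G)))
        (⊖-≤ _ _ d (psortable-bound sorts-in-d))
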